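{- Let $\mathsf{AP}$ be any finite set of atomic propositions. Then the concept class $(\mathsf{LTL}[\mathsf{AP}],\mathcal{W}^{\mathsf{fin}},\varphi\mapsto[\![\varphi]\!]\cap\mathcal{W}^{\mathsf{fin}})$ has characteristic samples; i.e. $\mathsf{LTL}[\mathsf{AP}]$ admits characteristic samples over $\mathcal{W}^{\mathsf{fin}}$.
   Context: $\mathcal{W}^{\mathsf{fin}}$ is the set of finite words over $2^{\mathsf{AP}}$. LTL syntax: $\varphi::=\top\mid p\mid\neg\varphi\mid\varphi\land\varphi\mid\mathsf{X}\varphi\mid\mathsf{F}\varphi\mid\varphi\,\mathsf{U}\,\varphi$, $p\in\mathsf{AP}$; semantics on a finite word $w$ with suffixes $w[i..]$: $w\models\top$; $w\models p$ iff $p\in w[0]$; $\neg,\land$ as usual; $w\models\mathsf{X}\varphi$ iff $|w|>1$ and $w[1..]\models\varphi$; $w\models\mathsf{F}\varphi$ iff some $i<|w|$ has $w[i..]\models\varphi$; $w\models\varphi\,\mathsf{U}\,\psi$ iff some $j<|w|$ has $w[j..]\models\psi$ and $w[i..]\models\varphi$ for all $i<j$. A concept class $(\Psi,\mathcal{X},[\![\cdot]\!])$ has concepts $\Psi$, instances $\mathcal{X}$, and $[\![\psi]\!]\subseteq\mathcal{X}$. A sample is a finite subset of $\mathcal{X}\times\{0,1\}$; $\psi$ fits $S$ if for all $(x,b)\in S$, $x\in[\![\psi]\!]$ iff $b=1$. A learner is a function $L$ from finite samples to $\Psi$ with $L(S)$ fitting $S$ whenever $S$ fits some element of $\Psi$;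 a teacher is a function $T$ from $\Psi$ to finite samples with $T(\psi)$ fitting $\psi$ (neither need be computable). $S$ is a characteristic sample for $\psi$ and $L$ if $S$ fits $\psi$ and for every sample $S'\supseteq S$ fitting $\psi$, $[\![L(S')]\!]=[\![\psi]\!]$. The class has characteristic samples if for some learner $L$ there is a teacher $T$ with $T(\psi)$ a characteristic sample for $\psi$ and $L$ for every $\psi\in\Psi$. -}

module Defs where

open import Data.Nat using (ℕ; _<_)
open import Data.Fin using (Fin; toℕ)
open import Data.Bool using (Bool; true; false; T)
open import Data.List using (List; []; _∷_; length; drop)
open import Data.List.Relation.Unary.All using (All)
open import Data.List.Membership.Propositional using (_∈_)
open import Data.Product using (Σ; _×_; _,_; ∃)
open import Data.Sum using (_⊎_)
open import Data.Unit using (⊤)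
open import Data.Empty using (⊥)
open import Relation.Nullary using (¬_)
open import Relation.Binary.PropositionalEquality using (_≡_)
open import Function.Bundles using (_⇔_)

record ConceptClass : Set₁ where
  field
    Concept  : Set
    Instance : Set
    ⟦_⟧      : Concept → Instance → Set

module _ (C : ConceptClass) where
  open ConceptClass C

  Sample : Set
  Sample = List (Instance × Bool)

  _⊆S_ : Sample → Sample → Set
  S ⊆S S' = ∀ {e} → e ∈ S → e ∈ S'

  Fits : Concept → Sample → Set
  Fits ψ S = All (λ e → ⟦ ψ ⟧ (Data.Product.proj₁ e) ⇔ (Data.Product.proj₂ e ≡ true)) S

  record Learner : Set where
    field
      learn : Sample → Concept
      sound : ∀ S → (Σ Concept λ ψ → Fits ψ S) → Fits (learn S) S

  SameLanguage : Concept → Concept → Set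
  SameLanguage φ ψ = ∀ x → ⟦ φ ⟧ x ⇔ ⟦ ψ ⟧ x

  IsCharacteristic : Learner → Concept → Sample → Set
  IsCharacteristic L ψ S =
    Fits ψ S × (∀ S' → S ⊆S S' → Fits ψ S' → SameLanguage (Learner.learn L S') ψ)

  record Teacher : Set where
    field
      teach : Concept → Sample
      sound : ∀ ψ → Fits ψ (teach ψ)

  HasCharacteristicSamples : Set
  HasCharacteristicSamples =
    Σ Learner λ L → Σ Teacher λ Tc →
      ∀ ψ → IsCharacteristic L ψ (Teacher.teach Tc ψ)

data LTL (n : ℕ) : Set where
  ⊤'   : LTL n
  atom : Fin n → LTL n
  ¬'_  : LTL n → LTL n
  _∧'_ : LTL n → LTL n → LTL n
  X'_  : LTL n → LTL n
  F'_  : LTL n → LTL n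
  _U'_ : LTL n → LTL n → LTL n

-- letters are subsets of AP (characteristic functions)
Letter : ℕ → Set
Letter n = Fin n → Bool

Word : ℕ → Set
Word n = List (Letter n)

suffix : ∀ {n} → Word n → ℕ → Word n
suffix w i = drop i w

holdsAt0 : ∀ {n} → Fin n → Word n → Set
holdsAt0 p []      = ⊥
holdsAt0 p (a ∷ w) = T (a p)

_⊨_ : ∀ {n} → Word n → LTL n → Set
w ⊨ ⊤'       = ⊤
w ⊨ atom p   = holdsAt0 p w
w ⊨ (¬' φ)   = ¬ (w ⊨ φ)
w ⊨ (φ ∧' ψ) = (w ⊨ φ) × (w ⊨ ψ)
w ⊨ (X' φ)   = (1 < length w) × (suffix w 1 ⊨ φ)
w ⊨ (F' φ)   = Σ ℕ λ i → (i < length w) × (suffix w i ⊨ φ)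
w ⊨ (φ U' ψ) = Σ ℕ λ j → (j < length w) × (suffix w j ⊨ ψ)
                 × (∀ i → i < j → suffix w i ⊨ φ)

LTL-fin : ℕ → ConceptClass
LTL-fin n = record
  { Concept  = LTL n
  ; Instance = Word n
  ; ⟦_⟧      = λ φ w → w ⊨ φ
  }

{-# OPTIONS --safe #-}
-- The learner returns the first formula, in an enumeration by nesting depth, that fits the
-- sample.  The teacher's sample for ψ contains a word of length depth ψ, so that this search
-- reaches ψ, together with all words up to a length bound, which refute every formula φ
-- enumerated before ψ that is not equivalent to ψ.  The bound comes from pumping: if two
-- suffixes of a word satisfy the same subformulas of φ ∧ ψ, the stretch between them can be
-- cut out without changing the truth of φ or of ψ, so φ and ψ are equivalent as soon as they
-- agree on all words no longer than the number of such profiles.  On samples that no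
-- enumerated formula fits, the learner falls back to the formula accepting exactly the
-- positive examples.
module Submission where

open import Defs
open import Data.Nat
  using (ℕ; zero; suc; _<_; _≤_; _≤′_; ≤′-refl; ≤′-step; s≤s; z<s; s<s; _*_; _⊔_; _≤?_; _<?_)
open import Data.Nat.Properties
  using (≤-trans; ≤-reflexive; <⇒≤; ≰⇒>; m∸n≤m; m<n⇒0<n∸m; m≤m⊔n; m≤n⊔m; ≤⇒≤′;
         anyUpTo?; allUpTo?)
open import Data.Nat.Induction using (<-wellFounded)
open import Data.Fin using (Fin; toℕ; combine)
open import Data.Fin.Patterns using (0F; 1F)
open import Data.Fin.Properties using (pigeonhole; combine-injective; toℕ<n)
open import Data.Bool using (Bool; true; false; T; if_then_else_)
import Data.Bool as Bool
open import Data.Bool.Properties using (T-≡)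
open import Data.List
  using (List; []; _∷_; [_]; _++_; length; take; drop; map; foldr; filter; head; replicate;
         allFin; cartesianProductWith)
open import Data.List.Properties
  using (length-drop; length-replicate; take++drop≡id; ++-identityʳ; ++-assoc; filter-++)
open import Data.List.Extrema.Nat using (max; xs≤max)
open import Data.List.Membership.Propositional using (_∈_)
open import Data.List.Membership.Propositional.Properties
  using (∈-map⁺; ∈-++⁺ˡ; ∈-++⁺ʳ; ∈-allFin; ∈-cartesianProductWith⁺; ∈-filter⁺; ∈-filter⁻)
open import Data.List.Relation.Unary.Any using (here; there)
open import Data.List.Relation.Unary.All as All using (All; []; _∷_)
open import Data.List.Relation.Unary.All.Properties using (all-filter; map⁺; map⁻)
open import Data.List.Relation.Binary.Pointwise using (Pointwise; []; _∷_; Pointwise-length)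
import Data.Vec.Functional as Vector
open import Data.Vec.Functional.Properties using (∷-cong)
open import Data.Maybe using (fromMaybe)
open import Data.Product using (Σ; ∃; _×_; _,_; proj₁; proj₂; uncurry)
open import Data.Product.Function.NonDependent.Propositional using (_×-⇔_)
open import Data.Sum using (_⊎_; inj₁; inj₂)
open import Data.Sum.Function.Propositional using (_⊎-⇔_)
open import Data.Unit using (tt)
open import Function using (_∘_; id; const)
open import Function.Bundles using (_⇔_; mk⇔; Equivalence)
open import Function.Construct.Identity using (⇔-id)
open import Function.Construct.Symmetry using (⇔-sym)
open import Function.Construct.Composition using (_⇔-∘_)
open import Function.Related.TypeIsomorphisms using (¬-cong-⇔)
open import Induction.WellFounded using (Acc; acc)
open import Relation.Binary.Construct.Closure.ReflexiveTransitive using (Star; ε; _◅_; _◅◅_)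
open import Relation.Binary.PropositionalEquality
  using (_≡_; _≗_; refl; sym; trans; cong; subst)
open import Relation.Nullary using (¬_; Dec; yes; no; does; contradiction)
open import Relation.Nullary.Decidable using (map′; _×-dec_; _→-dec_; T?; ¬?)

open Equivalence using (to; from)

private variable
  A B : Set
  n : ℕ

does≡true⇔ : (a? : Dec A) → A ⇔ (does a? ≡ true)
does≡true⇔ (yes a) = mk⇔ (λ _ → refl) (λ _ → a)
does≡true⇔ (no ¬a) = mk⇔ (λ a → contradiction a ¬a) (λ ())

_⇔?_ : Dec A → Dec B → Dec (A ⇔ B)
a? ⇔? b? = map′ (uncurry mk⇔) (λ e → to e , from e) ((a? →-dec b?) ×-dec (b? →-dec a?))

truthValue : Dec A → Fin 2
truthValue (yes _) = 1F
truthValue (no _)  = 0F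

≡-truthValue⇒⇔ : (a? : Dec A) (b? : Dec B) → truthValue a? ≡ truthValue b? → A ⇔ B
≡-truthValue⇒⇔ (yes a) (yes b) _ = mk⇔ (λ _ → b) (λ _ → a)
≡-truthValue⇒⇔ (no ¬a) (no ¬b) _ =
  mk⇔ (λ a → contradiction a ¬a) (λ b → contradiction b ¬b)

module _ (C : ConceptClass) where
  open ConceptClass C

  fits-true : ∀ ψ {S x} → Fits C ψ S → (x , true) ∈ S → ⟦ ψ ⟧ x
  fits-true ψ f m = from (All.lookup f m) refl

  fits-false : ∀ ψ {S x} → Fits C ψ S → (x , false) ∈ S → ¬ ⟦ ψ ⟧ x
  fits-false ψ f m h with () ← to (All.lookup f m) h

  fits-intro : ∀ ψ {S} → (∀ {x} → (x , true) ∈ S → ⟦ ψ ⟧ x) →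
               (∀ {x} → (x , false) ∈ S → ¬ ⟦ ψ ⟧ x) → Fits C ψ S
  fits-intro ψ {S} pos neg = All.tabulate fits-example
    where
    fits-example : ∀ {e} → e ∈ S → ⟦ ψ ⟧ (proj₁ e) ⇔ (proj₂ e ≡ true)
    fits-example {x , true}  m = mk⇔ (λ _ → refl) (λ _ → pos m)
    fits-example {x , false} m = mk⇔ (λ h → contradiction h (neg m)) (λ ())

module FirstConsistent (C : ConceptClass) where
  open ConceptClass C

  module _
    (_∈?_ : ∀ x ψ → Dec (⟦ ψ ⟧ x))
    (size : Instance → ℕ)
    (ofSize : ℕ → Instance)
    (≤-size-ofSize : ∀ d → d ≤ size (ofSize d))
    (candidates : ℕ → List Concept)
    (rank : Concept → ℕ)
    (∈-candidates : ∀ ψ → ψ ∈ candidates (rank ψ))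
    (candidates-++ : ∀ {d M} → d ≤ M → ∃ λ ys → candidates M ≡ candidates d ++ ys)
    (fallback : Sample C → Concept)
    (fallback-fits : ∀ ψ S → Fits C ψ S → Fits C (fallback S) S)
    (tests : Concept → List Instance)
    (tests-separate : ∀ ψ φ → φ ∈ candidates (rank ψ) →
                      (∀ {x} → x ∈ tests ψ → ⟦ φ ⟧ x ⇔ ⟦ ψ ⟧ x) → SameLanguage C φ ψ)
    where

    fits? : ∀ ψ S → Dec (Fits C ψ S)
    fits? ψ S = All.all? (λ (x , b) → (x ∈? ψ) ⇔? (b Bool.≟ true)) S

    maxSize : Sample C → ℕ
    maxSize S = max 0 (map (size ∘ proj₁) S)

    size≤maxSize : ∀ {x b S} → (x , b) ∈ S → size x ≤ maxSize S
    size≤maxSize {S = S} m =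
      All.lookup (xs≤max 0 (map (size ∘ proj₁) S)) (∈-map⁺ (size ∘ proj₁) m)

    consistent : Sample C → ℕ → List Concept
    consistent S d = filter (λ φ → fits? φ S) (candidates d)

    learn : Sample C → Concept
    learn S = fromMaybe (fallback S) (head (consistent S (maxSize S)))

    learn-fits : ∀ S → Σ Concept (λ ψ → Fits C ψ S) → Fits C (learn S) S
    learn-fits S (ψ , f) =
      go (consistent S (maxSize S)) (all-filter _ (candidates (maxSize S)))
      where
      go : ∀ φs → All (λ φ → Fits C φ S) φs → Fits C (fromMaybe (fallback S) (head φs)) S
      go []       _        = fallback-fits ψ S f
      go (φ ∷ φs) (fφ ∷ _) = fφ

    learn-∈ : ∀ {ψ S} → rank ψ ≤ maxSize S → Fits C ψ S →
              learn S ∈ consistent S (rank ψ)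
    learn-∈ {ψ} {S} rank≤ f with ys , eq ← candidates-++ rank≤
      rewrite eq | filter-++ (λ φ → fits? φ S) (candidates (rank ψ)) ys =
      go (∈-filter⁺ (λ φ → fits? φ S) (∈-candidates ψ) f)
      where
      go : ∀ {φs zs} → ψ ∈ φs → fromMaybe (fallback S) (head (φs ++ zs)) ∈ φs
      go {_ ∷ _} _ = here refl

    label : Concept → Instance → Instance × Bool
    label ψ x = x , does (x ∈? ψ)

    -- The first example forces maxSize S ≥ rank ψ, so that the search of learn S reaches ψ.
    teach : Concept → Sample C
    teach ψ = label ψ (ofSize (rank ψ)) ∷ map (label ψ) (tests ψ)

    teach-fits : ∀ ψ → Fits C ψ (teach ψ)
    teach-fits ψ = labelled (ofSize (rank ψ)) ∷ map⁺ (All.universal labelled (tests ψ))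
      where
      labelled : ∀ x → ⟦ ψ ⟧ x ⇔ (does (x ∈? ψ) ≡ true)
      labelled x = does≡true⇔ (x ∈? ψ)

    teach-characteristic : ∀ ψ S → _⊆S_ C (teach ψ) S → Fits C ψ S →
                           SameLanguage C (learn S) ψ
    teach-characteristic ψ S teach⊆S fψ = tests-separate ψ (learn S) (proj₁ learned) agree
      where
      rank≤ : rank ψ ≤ maxSize S
      rank≤ = ≤-trans (≤-size-ofSize (rank ψ)) (size≤maxSize (teach⊆S (here refl)))

      learned : learn S ∈ candidates (rank ψ) × Fits C (learn S) S
      learned = ∈-filter⁻ (λ φ → fits? φ S) {xs = candidates (rank ψ)} (learn-∈ rank≤ fψ)

      agree : ∀ {x} → x ∈ tests ψ → ⟦ learn S ⟧ x ⇔ ⟦ ψ ⟧ x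
      agree {x} x∈ =
        ⇔-sym (All.lookup fψ labelled∈S) ⇔-∘ All.lookup (proj₂ learned) labelled∈S
        where
        labelled∈S : label ψ x ∈ S
        labelled∈S = teach⊆S (there (∈-map⁺ (label ψ) x∈))

    hasCharacteristicSamples : HasCharacteristicSamples C
    hasCharacteristicSamples =
        record { learn = learn ; sound = learn-fits }
      , record { teach = teach ; sound = teach-fits }
      , λ ψ → teach-fits ψ , teach-characteristic ψ

_⊨?_ : (w : Word n) (φ : LTL n) → Dec (w ⊨ φ)
[]      ⊨? atom p = no λ ()
(a ∷ w) ⊨? atom p = T? (a p)
w ⊨? ⊤'       = yes tt
w ⊨? (¬' φ)   = ¬? (w ⊨? φ)
w ⊨? (φ ∧' ψ) = (w ⊨? φ) ×-dec (w ⊨? ψ)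
w ⊨? (X' φ)   = (1 <? length w) ×-dec (suffix w 1 ⊨? φ)
w ⊨? (F' φ)   = anyUpTo? (λ i → suffix w i ⊨? φ) (length w)
w ⊨? (φ U' ψ) =
  map′ (λ (j , j< , s , a) → j , j< , s , λ i → a {i})
       (λ (j , j< , s , a) → j , j< , s , λ {i} → a i)
       (anyUpTo? (λ j → (suffix w j ⊨? ψ) ×-dec allUpTo? (λ i → suffix w i ⊨? φ) j)
                 (length w))

private variable
  φ ψ θ : LTL n
  u v w : Word n
  a b : Letter n

infix 4 _▷_ _▷*_ _≈⟨_⟩_

data _▷_ {n} : LTL n → LTL n → Set where
  ¬▷  : ¬' φ ▷ φ
  ∧▷ˡ : φ ∧' ψ ▷ φ
  ∧▷ʳ : φ ∧' ψ ▷ ψ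
  X▷  : X' φ ▷ φ
  F▷  : F' φ ▷ φ
  U▷ˡ : φ U' ψ ▷ φ
  U▷ʳ : φ U' ψ ▷ ψ

_▷*_ : LTL n → LTL n → Set
_▷*_ = Star _▷_

_≈⟨_⟩_ : Word n → LTL n → Word n → Set
u ≈⟨ φ ⟩ v = ∀ {θ} → φ ▷* θ → (u ⊨ θ) ⇔ (v ⊨ θ)

≈-refl : u ≈⟨ φ ⟩ u
≈-refl _ = ⇔-id _

≈-trans : u ≈⟨ φ ⟩ v → v ≈⟨ φ ⟩ w → u ≈⟨ φ ⟩ w
≈-trans u≈v v≈w s = v≈w s ⇔-∘ u≈v s

≈-▷* : φ ▷* θ → u ≈⟨ φ ⟩ v → u ≈⟨ θ ⟩ v
≈-▷* s u≈v t = u≈v (s ◅◅ t)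

≈-▷ : φ ▷ θ → u ≈⟨ φ ⟩ v → u ≈⟨ θ ⟩ v
≈-▷ s = ≈-▷* (s ◅ ε)

≈⇒⇔ : u ≈⟨ φ ⟩ v → (u ⊨ φ) ⇔ (v ⊨ φ)
≈⇒⇔ u≈v = u≈v ε

X-∷ : ∀ (a : Letter n) u φ → ((a ∷ u) ⊨ (X' φ)) ⇔ (0 < length u × u ⊨ φ)
X-∷ _ _ _ = mk⇔ (λ { (s<s 0<u , h) → 0<u , h }) (λ (0<u , h) → s<s 0<u , h)

F-∷ : ∀ (a : Letter n) u φ → ((a ∷ u) ⊨ (F' φ)) ⇔ ((a ∷ u) ⊨ φ ⊎ u ⊨ (F' φ))
F-∷ a u φ = mk⇔ unfold fold
  where
  unfold : (a ∷ u) ⊨ (F' φ) → (a ∷ u) ⊨ φ ⊎ u ⊨ (F' φ)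
  unfold (zero  , _       , h) = inj₁ h
  unfold (suc i , s<s i<u , h) = inj₂ (i , i<u , h)

  fold : (a ∷ u) ⊨ φ ⊎ u ⊨ (F' φ) → (a ∷ u) ⊨ (F' φ)
  fold (inj₁ h)             = 0 , z<s , h
  fold (inj₂ (i , i<u , h)) = suc i , s<s i<u , h

U-∷ : ∀ (a : Letter n) u φ ψ →
      ((a ∷ u) ⊨ (φ U' ψ)) ⇔ ((a ∷ u) ⊨ ψ ⊎ ((a ∷ u) ⊨ φ × u ⊨ (φ U' ψ)))
U-∷ a u φ ψ = mk⇔ unfold fold
  where
  unfold : (a ∷ u) ⊨ (φ U' ψ) → (a ∷ u) ⊨ ψ ⊎ ((a ∷ u) ⊨ φ × u ⊨ (φ U' ψ))
  unfold (zero  , _       , h , _)      = inj₁ h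
  unfold (suc j , s<s j<u , h , before) =
    inj₂ (before 0 z<s , j , j<u , h , λ i i<j → before (suc i) (s<s i<j))

  fold : (a ∷ u) ⊨ ψ ⊎ ((a ∷ u) ⊨ φ × u ⊨ (φ U' ψ)) → (a ∷ u) ⊨ (φ U' ψ)
  fold (inj₁ h) = 0 , z<s , h , λ _ ()
  fold (inj₂ (h₀ , j , j<u , h , before)) = suc j , s<s j<u , h , λ where
    zero    _         → h₀
    (suc i) (s<s i<j) → before i i<j

-- The length hypothesis is needed for X: (a ∷ u) ⊨ X' ⊤' holds iff u is nonempty.
module _ {a b : Letter n} {u v : Word n}
         (a≗b : a ≗ b) (u≠[]⇔v≠[] : 0 < length u ⇔ 0 < length v) where

  ∷-⊨-cong : ∀ φ → u ≈⟨ φ ⟩ v → ((a ∷ u) ⊨ φ) ⇔ ((b ∷ v) ⊨ φ)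
  ∷-⊨-cong ⊤'       _   = ⇔-id _
  ∷-⊨-cong (atom p) _   = mk⇔ (subst T (a≗b p)) (subst T (sym (a≗b p)))
  ∷-⊨-cong (¬' φ)   u≈v = ¬-cong-⇔ (∷-⊨-cong φ (≈-▷ ¬▷ u≈v))
  ∷-⊨-cong (φ ∧' ψ) u≈v = ∷-⊨-cong φ (≈-▷ ∧▷ˡ u≈v) ×-⇔ ∷-⊨-cong ψ (≈-▷ ∧▷ʳ u≈v)
  ∷-⊨-cong (X' φ)   u≈v =
    ⇔-sym (X-∷ b v φ) ⇔-∘ ((u≠[]⇔v≠[] ×-⇔ ≈⇒⇔ (≈-▷ X▷ u≈v)) ⇔-∘ X-∷ a u φ)
  ∷-⊨-cong (F' φ)   u≈v =
    ⇔-sym (F-∷ b v φ) ⇔-∘ ((∷-⊨-cong φ (≈-▷ F▷ u≈v) ⊎-⇔ ≈⇒⇔ u≈v) ⇔-∘ F-∷ a u φ)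
  ∷-⊨-cong (φ U' ψ) u≈v =
    ⇔-sym (U-∷ b v φ ψ) ⇔-∘ ((now ⊎-⇔ (still ×-⇔ ≈⇒⇔ u≈v)) ⇔-∘ U-∷ a u φ ψ)
    where
    now : ((a ∷ u) ⊨ ψ) ⇔ ((b ∷ v) ⊨ ψ)
    now = ∷-⊨-cong ψ (≈-▷ U▷ʳ u≈v)

    still : ((a ∷ u) ⊨ φ) ⇔ ((b ∷ v) ⊨ φ)
    still = ∷-⊨-cong φ (≈-▷ U▷ˡ u≈v)

≈-∷ : a ≗ b → (0 < length u ⇔ 0 < length v) → u ≈⟨ φ ⟩ v → (a ∷ u) ≈⟨ φ ⟩ (b ∷ v)
≈-∷ a≗b u≠[]⇔v≠[] u≈v {θ} s = ∷-⊨-cong a≗b u≠[]⇔v≠[] θ (≈-▷* s u≈v)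

≈-pointwise : Pointwise _≗_ u v → u ≈⟨ φ ⟩ v
≈-pointwise []          = ≈-refl
≈-pointwise (a≗b ∷ u≗v) =
  ≈-∷ a≗b (mk⇔ (subst (0 <_) (Pointwise-length u≗v)) (subst (0 <_) (sym (Pointwise-length u≗v))))
      (≈-pointwise u≗v)

⊨-resp-≗ : ∀ φ → Pointwise _≗_ u v → (u ⊨ φ) ⇔ (v ⊨ φ)
⊨-resp-≗ φ u≗v = ≈⇒⇔ (≈-pointwise {φ = φ} u≗v)

≈-++ˡ : ∀ w → 0 < length u → 0 < length v → u ≈⟨ φ ⟩ v → (w ++ u) ≈⟨ φ ⟩ (w ++ v)
≈-++ˡ []      u≠[] v≠[] u≈v = u≈v
≈-++ˡ (a ∷ w) u≠[] v≠[] u≈v =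
  ≈-∷ (λ _ → refl) (mk⇔ (λ _ → ≠[]-++ w v≠[]) (λ _ → ≠[]-++ w u≠[])) (≈-++ˡ w u≠[] v≠[] u≈v)
  where
  ≠[]-++ : ∀ w → 0 < length v → 0 < length (w ++ v)
  ≠[]-++ []      v≠[] = v≠[]
  ≠[]-++ (_ ∷ _) _    = z<s

mutual
  #profiles : LTL n → ℕ
  #profiles φ = 2 * #subprofiles φ

  #subprofiles : LTL n → ℕ
  #subprofiles ⊤'       = 1
  #subprofiles (atom p) = 1
  #subprofiles (¬' φ)   = #profiles φ
  #subprofiles (φ ∧' ψ) = #profiles φ * #profiles ψ
  #subprofiles (X' φ)   = #profiles φ
  #subprofiles (F' φ)   = #profiles φ
  #subprofiles (φ U' ψ) = #profiles φ * #profiles ψ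

mutual
  profile : (φ : LTL n) → Word n → Fin (#profiles φ)
  profile φ w = combine (truthValue (w ⊨? φ)) (subprofile φ w)

  subprofile : (φ : LTL n) → Word n → Fin (#subprofiles φ)
  subprofile ⊤'       w = 0F
  subprofile (atom p) w = 0F
  subprofile (¬' φ)   w = profile φ w
  subprofile (φ ∧' ψ) w = combine (profile φ w) (profile ψ w)
  subprofile (X' φ)   w = profile φ w
  subprofile (F' φ)   w = profile φ w
  subprofile (φ U' ψ) w = combine (profile φ w) (profile ψ w)

profile-≡ : ∀ φ (u v : Word n) → profile φ u ≡ profile φ v →
            truthValue (u ⊨? φ) ≡ truthValue (v ⊨? φ) × subprofile φ u ≡ subprofile φ v
profile-≡ φ u v =
  combine-injective (truthValue (u ⊨? φ)) (subprofile φ u) (truthValue (v ⊨? φ)) (subprofile φ v)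

profile-pair-≡ : ∀ φ ψ (u v : Word n) →
                 combine (profile φ u) (profile ψ u) ≡ combine (profile φ v) (profile ψ v) →
                 profile φ u ≡ profile φ v × profile ψ u ≡ profile ψ v
profile-pair-≡ φ ψ u v = combine-injective (profile φ u) (profile ψ u) (profile φ v) (profile ψ v)

profile-▷ : ∀ u v → φ ▷ θ → profile φ u ≡ profile φ v → profile θ u ≡ profile θ v
profile-▷ {φ = φ} u v s same = go s (proj₂ (profile-≡ φ u v same))
  where
  go : ∀ {φ θ} → φ ▷ θ → subprofile φ u ≡ subprofile φ v → profile θ u ≡ profile θ v
  go ¬▷           = id
  go {φ ∧' ψ} ∧▷ˡ = proj₁ ∘ profile-pair-≡ φ ψ u v
  go {φ ∧' ψ} ∧▷ʳ = proj₂ ∘ profile-pair-≡ φ ψ u v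
  go X▷           = id
  go F▷           = id
  go {φ U' ψ} U▷ˡ = proj₁ ∘ profile-pair-≡ φ ψ u v
  go {φ U' ψ} U▷ʳ = proj₂ ∘ profile-pair-≡ φ ψ u v

profile-≈ : ∀ u v → profile φ u ≡ profile φ v → u ≈⟨ φ ⟩ v
profile-≈ {φ = φ} u v same ε = ≡-truthValue⇒⇔ (u ⊨? φ) (v ⊨? φ) (proj₁ (profile-≡ φ u v same))
profile-≈ u v same (s ◅ t) = profile-≈ u v (profile-▷ u v s same) t

length-take++drop : ∀ {i j} (xs : List A) → i < j → j ≤ length xs →
                    length (take i xs ++ drop j xs) < length xs
length-take++drop {i = zero}  {suc j} (x ∷ xs) _ _ =
  s≤s (≤-trans (≤-reflexive (length-drop j xs)) (m∸n≤m (length xs) j))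
length-take++drop {i = suc i} {suc j} (x ∷ xs) (s<s i<j) (s≤s j≤xs) =
  s<s (length-take++drop xs i<j j≤xs)

0<length-drop : ∀ (xs : List A) (k : Fin (length xs)) → 0 < length (drop (toℕ k) xs)
0<length-drop xs k = subst (0 <_) (sym (length-drop (toℕ k) xs)) (m<n⇒0<n∸m (toℕ<n k))

pump-down : ∀ φ (x : Word n) → #profiles φ < length x → ∃ λ y → length y < length x × x ≈⟨ φ ⟩ y
pump-down φ x long
  with i , j , i<j , same ← pigeonhole long (λ k → profile φ (drop (toℕ k) x)) =
  let y = take (toℕ i) x ++ drop (toℕ j) x
  in y , length-take++drop x i<j (<⇒≤ (toℕ<n j)) ,
     subst (_≈⟨ φ ⟩ y) (take++drop≡id (toℕ i) x)
       (≈-++ˡ (take (toℕ i) x) (0<length-drop x i) (0<length-drop x j)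
         (profile-≈ (drop (toℕ i) x) (drop (toℕ j) x) same))

shorten : ∀ φ (x : Word n) → ∃ λ y → length y ≤ #profiles φ × x ≈⟨ φ ⟩ y
shorten φ x = go x (<-wellFounded (length x))
  where
  go : ∀ x → Acc _<_ (length x) → ∃ λ y → length y ≤ #profiles φ × x ≈⟨ φ ⟩ y
  go x (acc smaller) with length x ≤? #profiles φ
  ... | yes short = x , short , ≈-refl
  ... | no ¬short =
    let y , y<x , x≈y = pump-down φ x (≰⇒> ¬short)
        z , z≤ , y≈z = go y (smaller y<x)
    in z , z≤ , ≈-trans x≈y y≈z

agree-on-short⇒equivalent : ∀ φ ψ → (∀ y → length y ≤ #profiles (φ ∧' ψ) → (y ⊨ φ) ⇔ (y ⊨ ψ)) →
                            ∀ (x : Word n) → (x ⊨ φ) ⇔ (x ⊨ ψ)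
agree-on-short⇒equivalent φ ψ agree x =
  let y , y≤ , x≈y = shorten (φ ∧' ψ) x
  in ⇔-sym (≈⇒⇔ (≈-▷ ∧▷ʳ x≈y)) ⇔-∘ (agree y y≤ ⇔-∘ ≈⇒⇔ (≈-▷ ∧▷ˡ x≈y))

letters : ∀ m → List (Fin m → Bool)
letters zero    = [ (λ ()) ]
letters (suc m) = cartesianProductWith Vector._∷_ (true ∷ false ∷ []) (letters m)

letters-complete : ∀ m (a : Fin m → Bool) → ∃ λ b → b ∈ letters m × a ≗ b
letters-complete zero    a = _ , here refl , λ ()
letters-complete (suc m) a =
  let b , b∈ , tail≗b = letters-complete m (Vector.tail a)
  in  Vector.head a Vector.∷ b ,
      ∈-cartesianProductWith⁺ Vector._∷_ (∈-bools (Vector.head a)) b∈ ,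
      ∷-cong refl tail≗b
  where
  ∈-bools : ∀ c → c ∈ true ∷ false ∷ []
  ∈-bools true  = here refl
  ∈-bools false = there (here refl)

words : ℕ → List (Word n)
words zero    = [ [] ]
words (suc B) = [] ∷ cartesianProductWith _∷_ (letters _) (words B)

words-complete : ∀ B (x : Word n) → length x ≤ B → ∃ λ y → y ∈ words B × Pointwise _≗_ x y
words-complete zero    []      _         = [] , here refl , []
words-complete (suc B) []      _         = [] , here refl , []
words-complete (suc B) (a ∷ x) (s≤s x≤B) =
  let b , b∈ , a≗b = letters-complete _ a
      y , y∈ , x≗y = words-complete B x x≤B
  in  b ∷ y , there (∈-cartesianProductWith⁺ _∷_ b∈ y∈) , a≗b ∷ x≗y

depth : LTL n → ℕ
depth ⊤'       = 0
depth (atom p) = 0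
depth (¬' φ)   = suc (depth φ)
depth (φ ∧' ψ) = suc (depth φ ⊔ depth ψ)
depth (X' φ)   = suc (depth φ)
depth (F' φ)   = suc (depth φ)
depth (φ U' ψ) = suc (depth φ ⊔ depth ψ)

extend : List (LTL n) → List (LTL n)
extend φs = map ¬'_ φs ++ map X'_ φs ++ map F'_ φs
         ++ cartesianProductWith _∧'_ φs φs ++ cartesianProductWith _U'_ φs φs

formulas : ℕ → List (LTL n)
formulas zero    = ⊤' ∷ map atom (allFin _)
formulas (suc d) = formulas d ++ extend (formulas d)

formulas-++ : ∀ {d M} → d ≤′ M → ∃ λ ys → formulas {n} M ≡ formulas d ++ ys
formulas-++ ≤′-refl = [] , sym (++-identityʳ _)
formulas-++ {d = d} (≤′-step {M} d≤′M) =
  let ys , eq = formulas-++ d≤′M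
  in  ys ++ extend (formulas M) ,
      trans (cong (_++ extend (formulas M)) eq) (++-assoc (formulas d) ys (extend (formulas M)))

formulas-mono : ∀ {d M} → d ≤ M → φ ∈ formulas d → φ ∈ formulas M
formulas-mono d≤M φ∈ with ys , eq ← formulas-++ (≤⇒≤′ d≤M) = subst (_ ∈_) (sym eq) (∈-++⁺ˡ φ∈)

module _ {φs : List (LTL n)} where
  private
    ¬s Xs Fs ∧s : List (LTL n)
    ¬s = map ¬'_ φs
    Xs = map X'_ φs
    Fs = map F'_ φs
    ∧s = cartesianProductWith _∧'_ φs φs

  ¬-∈-extend : φ ∈ φs → ¬' φ ∈ extend φs
  ¬-∈-extend = ∈-++⁺ˡ ∘ ∈-map⁺ ¬'_

  X-∈-extend : φ ∈ φs → X' φ ∈ extend φs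
  X-∈-extend = ∈-++⁺ʳ ¬s ∘ ∈-++⁺ˡ ∘ ∈-map⁺ X'_

  F-∈-extend : φ ∈ φs → F' φ ∈ extend φs
  F-∈-extend = ∈-++⁺ʳ ¬s ∘ ∈-++⁺ʳ Xs ∘ ∈-++⁺ˡ ∘ ∈-map⁺ F'_

  ∧-∈-extend : φ ∈ φs → ψ ∈ φs → φ ∧' ψ ∈ extend φs
  ∧-∈-extend φ∈ ψ∈ =
    ∈-++⁺ʳ ¬s (∈-++⁺ʳ Xs (∈-++⁺ʳ Fs (∈-++⁺ˡ (∈-cartesianProductWith⁺ _∧'_ φ∈ ψ∈))))

  U-∈-extend : φ ∈ φs → ψ ∈ φs → φ U' ψ ∈ extend φs
  U-∈-extend φ∈ ψ∈ =
    ∈-++⁺ʳ ¬s (∈-++⁺ʳ Xs (∈-++⁺ʳ Fs (∈-++⁺ʳ ∧s (∈-cartesianProductWith⁺ _U'_ φ∈ ψ∈))))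

∈-formulas : ∀ φ → φ ∈ formulas {n} (depth φ)
∈-formulas-⊔ : ∀ φ ψ → φ ∈ formulas {n} (depth φ ⊔ depth ψ) × ψ ∈ formulas (depth φ ⊔ depth ψ)

∈-formulas ⊤'       = here refl
∈-formulas (atom p) = there (∈-map⁺ atom (∈-allFin p))
∈-formulas (¬' φ)   = ∈-++⁺ʳ (formulas (depth φ)) (¬-∈-extend (∈-formulas φ))
∈-formulas (X' φ)   = ∈-++⁺ʳ (formulas (depth φ)) (X-∈-extend (∈-formulas φ))
∈-formulas (F' φ)   = ∈-++⁺ʳ (formulas (depth φ)) (F-∈-extend (∈-formulas φ))
∈-formulas (φ ∧' ψ) = ∈-++⁺ʳ (formulas (depth φ ⊔ depth ψ)) (uncurry ∧-∈-extend (∈-formulas-⊔ φ ψ))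
∈-formulas (φ U' ψ) = ∈-++⁺ʳ (formulas (depth φ ⊔ depth ψ)) (uncurry U-∈-extend (∈-formulas-⊔ φ ψ))

∈-formulas-⊔ φ ψ = formulas-mono (m≤m⊔n (depth φ) (depth ψ)) (∈-formulas φ)
                 , formulas-mono (m≤n⊔m (depth φ) (depth ψ)) (∈-formulas ψ)

⋀ : List (LTL n) → LTL n
⋀ = foldr _∧'_ ⊤'

⊨-⋀ : ∀ (w : Word n) φs → (w ⊨ ⋀ φs) ⇔ All (w ⊨_) φs
⊨-⋀ w []       = mk⇔ (λ _ → []) (λ _ → tt)
⊨-⋀ w (φ ∷ φs) = mk⇔ (λ (h , hs) → h ∷ to (⊨-⋀ w φs) hs)
                     (λ { (h ∷ hs) → h , from (⊨-⋀ w φs) hs })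

literal : Letter n → Fin n → LTL n
literal a p = if a p then atom p else ¬' atom p

¬T⇔≡false : ∀ {b} → (¬ T b) ⇔ (b ≡ false)
¬T⇔≡false {true}  = mk⇔ (λ ¬t → contradiction tt ¬t) (λ ())
¬T⇔≡false {false} = mk⇔ (λ _ → refl) (λ _ ())

literal-⇔ : ∀ (c : Letter n) w a p → ((c ∷ w) ⊨ literal a p) ⇔ (c p ≡ a p)
literal-⇔ c w a p with a p
... | true  = T-≡
... | false = ¬T⇔≡false

-- The conjunct F' ⊤' rules out the empty word, which satisfies every negated atom.
letter : Letter n → LTL n
letter a = ⋀ (F' ⊤' ∷ map (literal a) (allFin _))

letter-self : ∀ a (w : Word n) → (a ∷ w) ⊨ letter a
letter-self a w = from (⊨-⋀ (a ∷ w) (F' ⊤' ∷ map (literal a) (allFin _)))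
  ((0 , z<s , tt) ∷ map⁺ (All.universal (λ p → from (literal-⇔ a w a p) refl) (allFin _)))

letter-≗ : ∀ c (w : Word n) a → (c ∷ w) ⊨ letter a → c ≗ a
letter-≗ c w a (_ , h) p = to (literal-⇔ c w a p) (All.lookup literals (∈-allFin p))
  where
  literals : All (λ p → (c ∷ w) ⊨ literal a p) (allFin _)
  literals = map⁻ (to (⊨-⋀ (c ∷ w) (map (literal a) (allFin _))) h)

mutual
  exactly : Word n → LTL n
  exactly []      = ¬' F' ⊤'
  exactly (a ∷ w) = letter a ∧' tailIs w

  tailIs : Word n → LTL n
  tailIs []      = ¬' X' ⊤'
  tailIs (a ∷ w) = X' exactly (a ∷ w)

exactly-self : ∀ w → w ⊨ exactly {n} w
exactly-self []          (_ , () , _)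
exactly-self (a ∷ [])    = letter-self a [] , λ { (s<s () , _) }
exactly-self (a ∷ b ∷ w) = letter-self a (b ∷ w) , s<s z<s , exactly-self (b ∷ w)

mutual
  exactly-sound : ∀ (x w : Word n) → x ⊨ exactly w → Pointwise _≗_ x w
  exactly-sound []      []      _           = []
  exactly-sound (_ ∷ _) []      x≠[]        = contradiction (0 , z<s , tt) x≠[]
  exactly-sound []      (_ ∷ _) (((_ , () , _) , _) , _)
  exactly-sound (c ∷ x) (a ∷ w) (h , tail⊨) = letter-≗ c x a h ∷ tailIs-sound x w tail⊨

  tailIs-sound : ∀ {c} (x w : Word n) → (c ∷ x) ⊨ tailIs w → Pointwise _≗_ x w
  tailIs-sound []      []      _       = []
  tailIs-sound (_ ∷ _) []      last    = contradiction (s<s z<s , tt) last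
  tailIs-sound x       (a ∷ w) (_ , h) = exactly-sound x (a ∷ w) h

notPositive : Word n × Bool → LTL n
notPositive (w , true)  = ¬' exactly w
notPositive (w , false) = ⊤'

rote : Sample (LTL-fin n) → LTL n
rote S = ¬' ⋀ (map notPositive S)

rote-fits : ∀ (ψ : LTL n) S → Fits (LTL-fin n) ψ S → Fits (LTL-fin n) (rote S) S
rote-fits ψ S fψ = fits-intro (LTL-fin _) (rote S) positive negative
  where
  ⊨-notPositive : ∀ x → (x ⊨ ⋀ (map notPositive S)) ⇔ All (λ e → x ⊨ notPositive e) S
  ⊨-notPositive x = mk⇔ (map⁻ ∘ to (⊨-⋀ x (map notPositive S)))
                        (from (⊨-⋀ x (map notPositive S)) ∘ map⁺)

  positive : ∀ {x} → (x , true) ∈ S → x ⊨ rote S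
  positive {x} x∈ h = All.lookup (to (⊨-notPositive x) h) x∈ (exactly-self x)

  negative : ∀ {x} → (x , false) ∈ S → ¬ (x ⊨ rote S)
  negative {x} x∈ ¬h = ¬h (from (⊨-notPositive x) (All.tabulate not-positive))
    where
    not-positive : ∀ {e} → e ∈ S → x ⊨ notPositive e
    not-positive {w , true}  w∈ x⊨w = fits-false (LTL-fin _) ψ fψ x∈
      (from (⊨-resp-≗ ψ (exactly-sound x w x⊨w)) (fits-true (LTL-fin _) ψ fψ w∈))
    not-positive {w , false} _ = tt

bound : LTL n → ℕ
bound ψ = max 0 (map (λ φ → #profiles (φ ∧' ψ)) (formulas (depth ψ)))

#profiles≤bound : ∀ (φ ψ : LTL n) → φ ∈ formulas (depth ψ) → #profiles (φ ∧' ψ) ≤ bound ψ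
#profiles≤bound φ ψ φ∈ =
  All.lookup (xs≤max 0 (map (λ φ → #profiles (φ ∧' ψ)) (formulas (depth ψ))))
             (∈-map⁺ (λ φ → #profiles (φ ∧' ψ)) φ∈)

words-separate : ∀ (ψ φ : LTL n) → φ ∈ formulas (depth ψ) →
                 (∀ {x} → x ∈ words (bound ψ) → (x ⊨ φ) ⇔ (x ⊨ ψ)) →
                 ∀ x → (x ⊨ φ) ⇔ (x ⊨ ψ)
words-separate ψ φ φ∈ agree = agree-on-short⇒equivalent φ ψ λ y y≤ →
  let z , z∈ , y≗z = words-complete (bound ψ) y (≤-trans y≤ (#profiles≤bound φ ψ φ∈))
  in  ⇔-sym (⊨-resp-≗ ψ y≗z) ⇔-∘ (agree z∈ ⇔-∘ ⊨-resp-≗ φ y≗z)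

theorem33 : (n : ℕ) → HasCharacteristicSamples (LTL-fin n)
theorem33 n = FirstConsistent.hasCharacteristicSamples (LTL-fin n)
  (λ w φ → w ⊨? φ)
  length (λ d → replicate d (const false)) (λ d → ≤-reflexive (sym (length-replicate d)))
  formulas depth ∈-formulas (formulas-++ ∘ ≤⇒≤′)
  rote rote-fits
  (words ∘ bound) words-separate
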